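{- Let $n$ and $m$ be integers with $2\le m\le\lfloor n/2\rfloor$. Then $m(K^1_{n-m,m},t)\le m(K^1_{n-1,1},t)$ for all $t=0,1,\dots,\lfloor n/2\rfloor$.
   Context: $m(G,t)$ is the number of $t$-matchings (sets of $t$ pairwise disjoint edges) of $G$, $m(G,0)=1$. For positive integers $a\ge b$, $K^1_{a,b}$ denotes the graph obtained from the disjoint union $K_a\cup K_b$ by adding one edge joining a vertex of $K_a$ to a vertex of $K_b$. -}

module Defs where

open import Data.Nat using (ℕ; _<ᵇ_; _≡ᵇ_)
open import Data.Bool using (Bool; true; false; _∧_; _∨_; not; if_then_else_)
open import Data.Fin using (Fin; toℕ)
open import Data.Product using (_×_; _,_)
open import Data.List using (List; []; _∷_; _++_; map; concatMap; filterᵇ; length; allFin)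

-- Only the pairs i < j (as naturals) with adj i j = true are
-- edges, so edges are unordered pairs and loops are ignored.
Graph : ℕ → Set
Graph n = Fin n → Fin n → Bool

Edge : ℕ → Set
Edge n = Fin n × Fin n

edges : ∀ {n} → Graph n → List (Edge n)
edges {n} G =
  filterᵇ (λ { (i , j) → (toℕ i <ᵇ toℕ j) ∧ G i j })
          (concatMap (λ i → map (λ j → (i , j)) (allFin n)) (allFin n))

-- all sub-lists (= subsets, since the edge list has no duplicates)
sublists : ∀ {A : Set} → List A → List (List A)
sublists []       = [] ∷ []
sublists (x ∷ xs) = let r = sublists xs in map (x ∷_) r ++ r

_=ᶠ_ : ∀ {n} → Fin n → Fin n → Bool
i =ᶠ j = toℕ i ≡ᵇ toℕ j

disjointᵇ : ∀ {n} → Edge n → Edge n → Bool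
disjointᵇ (a , b) (c , d) =
  not ((a =ᶠ c) ∨ (a =ᶠ d) ∨ (b =ᶠ c) ∨ (b =ᶠ d))

allᵇ : ∀ {A : Set} → (A → Bool) → List A → Bool
allᵇ p []       = true
allᵇ p (x ∷ xs) = p x ∧ allᵇ p xs

matchingᵇ : ∀ {n} → List (Edge n) → Bool
matchingᵇ []       = true
matchingᵇ (e ∷ es) = allᵇ (disjointᵇ e) es ∧ matchingᵇ es

m : ∀ {n} → Graph n → ℕ → ℕ
m G t = length (filterᵇ (λ s → (length s ≡ᵇ t) ∧ matchingᵇ s) (sublists (edges G)))

-- K^1_{a,b}: vertices 0..a-1 form K_a, vertices a..a+b-1 form K_b,
-- plus the single edge joining vertex 0 (of K_a) and vertex a (of K_b).
K1 : (a b : ℕ) → Graph (a Data.Nat.+ b)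
K1 a b i j =
  let x = toℕ i ; y = toℕ j
      sideA : ℕ → Bool
      sideA v = v <ᵇ a
  in not (x ≡ᵇ y) ∧
     ( (sideA x ∧ sideA y)
     ∨ (not (sideA x) ∧ not (sideA y))
     ∨ ((x ≡ᵇ 0) ∧ (y ≡ᵇ a))
     ∨ ((x ≡ᵇ a) ∧ (y ≡ᵇ 0)) )

module Submission where

-- Deleting vertex 0 gives the exact formula (matchings-K1)
--   m(K1 (a+1) (b+1), t+1) = m(K_(a+1) ∪ K_(b+1), t+1) + m(K_a ∪ K_b, t),
-- so the theorem, for n - k = p+1 and k = q+1, amounts to the inequality
--   m(K_(p+1) ∪ K_(q+1), t+1) + m(K_p ∪ K_q, t) ≤ m(K_(p+q+1), t+1) + m(K_(p+q), t).
-- This inequality is proved first, purely arithmetically, from the vertex recursions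
-- for mK n t = m(K_n, t) and mKK p q t = m(K_p ∪ K_q, t): the key estimate is that the
-- matchings of K_(p+q) with at most one edge between K_p and K_q are at most all of them.

open import Defs
open import Data.Nat using (ℕ; zero; suc; pred; _+_; _*_; _∸_; _/_; _≡ᵇ_; _<ᵇ_; _<_; _≤_; z≤n; s≤s)
open import Data.Nat.Properties
  using (≤-refl; ≤-reflexive; ≤-trans; <⇒≤; ≤⇒≯; n≤1+n; m≤m+n; m≤n+m;
         +-mono-≤; +-monoˡ-≤; +-monoʳ-≤; *-mono-≤; *-monoˡ-≤; *-monoʳ-≤;
         +-suc; +-assoc; +-comm; +-identityʳ; *-comm; *-zeroʳ; *-distribʳ-+;
         ≡ᵇ⇒≡; ≡⇒≡ᵇ; <⇒<ᵇ; <ᵇ⇒<; <⇒≢; >⇒≢;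
         m+n≤o⇒n≤o; m+n≤o⇒m≤o∸n; m∸n+n≡m; module ≤-Reasoning)
open import Data.Nat.DivMod using (m/n*n≤m)
open import Data.Nat.ListAction using (sum)
open import Data.Nat.Tactic.RingSolver using (solve-∀)
open import Data.Bool using (Bool; true; false; _∧_; _∨_; not; T; T?; if_then_else_)
open import Data.Bool.Properties using (∧-assoc; ∧-comm; T-≡)
open import Data.Empty using (⊥-elim)
open import Data.Fin using (Fin; toℕ)
import Data.Fin as Fin
open import Data.Product using (Σ; _×_; _,_; proj₁; proj₂)
open import Data.List using (List; []; _∷_; _++_; map; filterᵇ; length; concatMap; tabulate; allFin)
open import Data.List.Properties
  using (filter-++; length-++; length-map; map-∘; map-++; map-cong-local;
         map-concatMap; concatMap-map; concatMap-cong; map-tabulate)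
open import Data.List.Relation.Unary.All as All using (All; []; _∷_)
import Data.List.Relation.Unary.All.Properties as Allₚ
open import Data.List.Relation.Unary.AllPairs using (AllPairs; []; _∷_)
import Data.List.Relation.Unary.AllPairs.Properties as AllPairsₚ
open import Data.List.Relation.Unary.Any using (here; there)
open import Data.List.Membership.Propositional using (_∈_)
open import Function using (_∘_; Equivalence)
open import Relation.Nullary using (¬_)
open import Relation.Binary.PropositionalEquality

-- mK n t = m(K_n, t).  A t-matching of K_(n+1) either avoids the last vertex
-- or matches it to one of the other n vertices.
mK : ℕ → ℕ → ℕ
mK n       zero    = 1
mK zero    (suc t) = 0
mK (suc n) (suc t) = mK n (suc t) + n * mK (pred n) t

-- mKK p q t = m(K_p ∪ K_q, t), by the same recursion on the vertices of K_q.
mKK : ℕ → ℕ → ℕ → ℕ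
mKK p zero    t       = mK p t
mKK p (suc q) zero    = 1
mKK p (suc q) (suc t) = mKK p q (suc t) + q * mKK p (pred q) t

-- mCross p q t: t-matchings of K_(p+q) = K_p ∪ K_q ∪ (all p·q cross edges)
-- using exactly one cross edge.
mCross : ℕ → ℕ → ℕ → ℕ
mCross p q zero    = 0
mCross p q (suc t) = p * q * mKK (pred p) (pred q) t

mKK-zero : ∀ p q → mKK p q 0 ≡ 1
mKK-zero p zero    = refl
mKK-zero p (suc q) = refl

mKK-row : ∀ p q t → mKK (suc p) q (suc t) ≡ mKK p q (suc t) + p * mKK (pred p) q t
mKK-row p zero    t       = refl
mKK-row p (suc q) zero    =
  begin
    mKK (suc p) q 1 + q * mKK (suc p) (pred q) 0
  ≡⟨ cong₂ (λ a b → a + q * b) (mKK-row p q zero) (mKK-zero (suc p) (pred q)) ⟩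
    (mKK p q 1 + p * mKK (pred p) q 0) + q * 1
  ≡⟨ cong₂ (λ a b → (mKK p q 1 + p * a) + q * b) (mKK-zero (pred p) q) (sym (mKK-zero p (pred q))) ⟩
    (mKK p q 1 + p * 1) + q * mKK p (pred q) 0
  ≡⟨ swap (mKK p q 1) p q (mKK p (pred q) 0) ⟩
    (mKK p q 1 + q * mKK p (pred q) 0) + p * 1
  ∎
  where
  open ≡-Reasoning
  swap : ∀ a b c d → (a + b * 1) + c * d ≡ (a + c * d) + b * 1
  swap = solve-∀
mKK-row p (suc q) (suc t) =
  begin
    mKK (suc p) q (suc (suc t)) + q * mKK (suc p) (pred q) (suc t)
  ≡⟨ cong₂ (λ a b → a + q * b) (mKK-row p q (suc t)) (mKK-row p (pred q) t) ⟩
    (mKK p q (suc (suc t)) + p * mKK (pred p) q (suc t)) + q * (mKK p (pred q) (suc t) + p * mKK (pred p) (pred q) t)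
  ≡⟨ regroup (mKK p q (suc (suc t))) p (mKK (pred p) q (suc t)) q (mKK p (pred q) (suc t)) (mKK (pred p) (pred q) t) ⟩
    (mKK p q (suc (suc t)) + q * mKK p (pred q) (suc t)) + p * (mKK (pred p) q (suc t) + q * mKK (pred p) (pred q) t)
  ∎
  where
  open ≡-Reasoning
  regroup : ∀ a p b q c d → (a + p * b) + q * (c + p * d) ≡ (a + q * c) + p * (b + q * d)
  regroup = solve-∀

-- K_p ∪ K_q is a spanning subgraph of K_(p+q).
mKK≤mK : ∀ p q t → mKK p q t ≤ mK (p + q) t
mKK≤mK p zero    t       = ≤-reflexive (cong (λ n → mK n t) (sym (+-identityʳ p)))
mKK≤mK p (suc q) zero    = ≤-refl
mKK≤mK p (suc q) (suc t) rewrite +-suc p q =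
  +-mono-≤ (mKK≤mK p q (suc t)) (lastVertex q)
  where
  lastVertex : ∀ q → q * mKK p (pred q) t ≤ (p + q) * mK (pred (p + q)) t
  lastVertex zero = z≤n
  lastVertex (suc q) rewrite +-suc p q = *-mono-≤ (s≤s (m≤n+m q p)) (mKK≤mK p q t)

mCross-zeroʳ : ∀ p t → mCross p 0 t ≡ 0
mCross-zeroʳ p zero    = refl
mCross-zeroʳ p (suc t) = cong (_* mKK (pred p) 0 t) (*-zeroʳ p)

-- Cross matchings of K_p ∪ K_(q+1) split by how the last vertex v of K_(q+1) is used:
-- v uncovered, v matched inside K_(q+1), or v matched to K_p by the single cross edge.
mCross-split : ∀ p q t →
  mCross p (suc q) (suc t) ≡ mCross p q (suc t) + q * mCross p (pred q) t + p * mKK (pred p) q t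
mCross-split p zero t = expand p (mKK (pred p) 0 t) (mKK (pred p) 0 t)
  where
  expand : ∀ p x y → p * 1 * x ≡ p * 0 * y + 0 + p * x
  expand = solve-∀
mCross-split p (suc q) zero
  rewrite mKK-zero (pred p) (suc q) | mKK-zero (pred p) q = expand p q
  where
  expand : ∀ p q → p * suc (suc q) * 1 ≡ p * suc q * 1 + suc q * 0 + p * 1
  expand = solve-∀
mCross-split p (suc q) (suc t) =
  expand p q (mKK (pred p) q (suc t)) (mKK (pred p) (pred q) t)
  where
  expand : ∀ p q x y →
    p * suc (suc q) * (x + q * y) ≡ p * suc q * x + suc q * (p * q * y) + p * (x + q * y)
  expand = solve-∀

-- Matchings of K_(p+q) with at most one cross edge: their number is at most m(K_(p+q), t).
mKK+mCross≤mK : ∀ p q t → mKK p q t + mCross p q t ≤ mK (p + q) t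
mKK+mCross≤mK p q zero rewrite mKK-zero p q = ≤-refl
mKK+mCross≤mK p zero (suc t) =
  subst (_≤ mK (p + 0) (suc t)) (sym (trans (cong (mK p (suc t) +_) (mCross-zeroʳ p (suc t))) (+-identityʳ _)))
        (mKK≤mK p 0 (suc t))
mKK+mCross≤mK p (suc q) (suc t) =
  begin
    mKK p q (suc t) + q * mKK p (pred q) t + mCross p (suc q) (suc t)
  ≡⟨ cong (mKK p q (suc t) + q * mKK p (pred q) t +_) (mCross-split p q t) ⟩
    mKK p q (suc t) + q * mKK p (pred q) t + (mCross p q (suc t) + q * mCross p (pred q) t + p * mKK (pred p) q t)
  ≡⟨ regroup (mKK p q (suc t)) q (mKK p (pred q) t) (mCross p q (suc t)) (mCross p (pred q) t) p (mKK (pred p) q t) ⟩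
    (mKK p q (suc t) + mCross p q (suc t)) + q * (mKK p (pred q) t + mCross p (pred q) t) + p * mKK (pred p) q t
  ≤⟨ +-mono-≤ (+-mono-≤ (mKK+mCross≤mK p q (suc t)) (*-monoʳ-≤ q (mKK+mCross≤mK p (pred q) t)))
              (*-monoʳ-≤ p (mKK≤mK (pred p) q t)) ⟩
    mK (p + q) (suc t) + q * mK (p + pred q) t + p * mK (pred p + q) t
  ≡⟨ cong₂ (λ a b → mK (p + q) (suc t) + a + b) (lastOfK_q q) (lastOfK_p p) ⟩
    mK (p + q) (suc t) + q * mK (pred (p + q)) t + p * mK (pred (p + q)) t
  ≡⟨ trans (+-assoc (mK (p + q) (suc t)) _ _)
           (cong (mK (p + q) (suc t) +_) (sym (*-distribʳ-+ (mK (pred (p + q)) t) q p))) ⟩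
    mK (p + q) (suc t) + (q + p) * mK (pred (p + q)) t
  ≡⟨ cong (λ a → mK (p + q) (suc t) + a * mK (pred (p + q)) t) (+-comm q p) ⟩
    mK (suc (p + q)) (suc t)
  ≡⟨ cong (λ n → mK n (suc t)) (sym (+-suc p q)) ⟩
    mK (p + suc q) (suc t)
  ∎
  where
  open ≤-Reasoning
  regroup : ∀ a q b c d p e → a + q * b + (c + q * d + p * e) ≡ (a + c) + q * (b + d) + p * e
  regroup = solve-∀
  -- the weights q and p kill the cases where pred does not commute with +
  lastOfK_q : ∀ q → q * mK (p + pred q) t ≡ q * mK (pred (p + q)) t
  lastOfK_q zero    = refl
  lastOfK_q (suc q) = cong (λ n → suc q * mK (pred n) t) (sym (+-suc p q))
  lastOfK_p : ∀ p → p * mK (pred p + q) t ≡ p * mK (pred (p + q)) t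
  lastOfK_p zero    = refl
  lastOfK_p (suc p) = refl

-- Matchings of K_(p+1) ∪ K_q covering the last vertex of K_q, bounded by cross
-- matchings: re-attach that vertex to the first vertex of K_(p+1) instead.
lastVertex≤mCross : ∀ p q t → q * mKK (suc p) (pred q) t ≤ mCross (suc p) q (suc t) + mCross p q t
lastVertex≤mCross p q zero rewrite mKK-zero (suc p) (pred q) | mKK-zero p (pred q) =
  ≤-trans (m≤m+n (q * 1) (p * q * 1)) (≤-reflexive (expand p q))
  where
  expand : ∀ p q → q * 1 + p * q * 1 ≡ suc p * q * 1 + 0
  expand = solve-∀
lastVertex≤mCross p q (suc t) =
  begin
    q * mKK (suc p) (pred q) (suc t)
  ≡⟨ cong (q *_) (mKK-row p (pred q) t) ⟩
    q * (a + p * b)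
  ≡⟨ distribute q a p b ⟩
    q * a + p * q * b
  ≤⟨ +-monoˡ-≤ (p * q * b) (m≤m+n (q * a) (p * q * a)) ⟩
    q * a + p * q * a + p * q * b
  ≡⟨ cong (_+ p * q * b) (collect p q a) ⟩
    suc p * q * a + p * q * b
  ∎
  where
  open ≤-Reasoning
  a b : ℕ
  a = mKK p (pred q) (suc t)
  b = mKK (pred p) (pred q) t
  distribute : ∀ q a p b → q * (a + p * b) ≡ q * a + p * q * b
  distribute = solve-∀
  collect : ∀ p q a → q * a + p * q * a ≡ suc p * q * a
  collect = solve-∀

twoCliques≤clique : ∀ p q t →
  mKK (suc p) (suc q) (suc t) + mKK p q t ≤ mK (suc (p + q)) (suc t) + mK (p + q) t
twoCliques≤clique p q t =
  begin
    mKK (suc p) q (suc t) + q * mKK (suc p) (pred q) t + mKK p q t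
  ≤⟨ +-monoˡ-≤ (mKK p q t) (+-monoʳ-≤ (mKK (suc p) q (suc t)) (lastVertex≤mCross p q t)) ⟩
    mKK (suc p) q (suc t) + (mCross (suc p) q (suc t) + mCross p q t) + mKK p q t
  ≡⟨ regroup (mKK (suc p) q (suc t)) (mCross (suc p) q (suc t)) (mCross p q t) (mKK p q t) ⟩
    (mKK (suc p) q (suc t) + mCross (suc p) q (suc t)) + (mKK p q t + mCross p q t)
  ≤⟨ +-mono-≤ (mKK+mCross≤mK (suc p) q (suc t)) (mKK+mCross≤mK p q t) ⟩
    mK (suc (p + q)) (suc t) + mK (p + q) t
  ∎
  where
  open ≤-Reasoning
  regroup : ∀ a b c d → a + (b + c) + d ≡ (a + b) + (d + c)
  regroup = solve-∀

filterᵇ-cong : ∀ {A : Set} {p q : A → Bool} {xs : List A} →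
  All (λ x → p x ≡ q x) xs → filterᵇ p xs ≡ filterᵇ q xs
filterᵇ-cong [] = refl
filterᵇ-cong {p = p} {q} {x ∷ xs} (px≡qx ∷ h) with p x | q x | px≡qx
... | true  | .true  | refl = cong (x ∷_) (filterᵇ-cong h)
... | false | .false | refl = filterᵇ-cong h

filterᵇ-none : ∀ {A : Set} {p : A → Bool} {xs : List A} →
  All (λ x → p x ≡ false) xs → filterᵇ p xs ≡ []
filterᵇ-none [] = refl
filterᵇ-none (px ∷ h) rewrite px = filterᵇ-none h

filterᵇ-all : ∀ {A : Set} {p : A → Bool} {xs : List A} →
  All (λ x → p x ≡ true) xs → filterᵇ p xs ≡ xs
filterᵇ-all [] = refl
filterᵇ-all {xs = x ∷ _} (px ∷ h) rewrite px = cong (x ∷_) (filterᵇ-all h)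

filterᵇ-accept : ∀ {A : Set} {p : A → Bool} {x : A} (xs : List A) →
  p x ≡ true → filterᵇ p (x ∷ xs) ≡ x ∷ filterᵇ p xs
filterᵇ-accept xs px rewrite px = refl

filterᵇ-reject : ∀ {A : Set} {p : A → Bool} {x : A} (xs : List A) →
  p x ≡ false → filterᵇ p (x ∷ xs) ≡ filterᵇ p xs
filterᵇ-reject xs px rewrite px = refl

filterᵇ-map : ∀ {A B : Set} (p : B → Bool) (f : A → B) (xs : List A) →
  filterᵇ p (map f xs) ≡ map f (filterᵇ (p ∘ f) xs)
filterᵇ-map p f []       = refl
filterᵇ-map p f (x ∷ xs) with p (f x)
... | true  = cong (f x ∷_) (filterᵇ-map p f xs)
... | false = filterᵇ-map p f xs

filterᵇ-comm : ∀ {A : Set} (p q : A → Bool) (xs : List A) →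
  filterᵇ p (filterᵇ q xs) ≡ filterᵇ q (filterᵇ p xs)
filterᵇ-comm p q []       = refl
filterᵇ-comm p q (x ∷ xs) = byCases (p x) (q x) refl refl
  where
  open ≡-Reasoning
  byCases : ∀ b c → p x ≡ b → q x ≡ c →
    filterᵇ p (filterᵇ q (x ∷ xs)) ≡ filterᵇ q (filterᵇ p (x ∷ xs))
  byCases true true px qx = begin
    filterᵇ p (filterᵇ q (x ∷ xs))  ≡⟨ cong (filterᵇ p) (filterᵇ-accept xs qx) ⟩
    filterᵇ p (x ∷ filterᵇ q xs)    ≡⟨ filterᵇ-accept (filterᵇ q xs) px ⟩
    x ∷ filterᵇ p (filterᵇ q xs)    ≡⟨ cong (x ∷_) (filterᵇ-comm p q xs) ⟩
    x ∷ filterᵇ q (filterᵇ p xs)    ≡⟨ filterᵇ-accept (filterᵇ p xs) qx ⟨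
    filterᵇ q (x ∷ filterᵇ p xs)    ≡⟨ cong (filterᵇ q) (filterᵇ-accept xs px) ⟨
    filterᵇ q (filterᵇ p (x ∷ xs))  ∎
  byCases true false px qx = begin
    filterᵇ p (filterᵇ q (x ∷ xs))  ≡⟨ cong (filterᵇ p) (filterᵇ-reject xs qx) ⟩
    filterᵇ p (filterᵇ q xs)        ≡⟨ filterᵇ-comm p q xs ⟩
    filterᵇ q (filterᵇ p xs)        ≡⟨ filterᵇ-reject (filterᵇ p xs) qx ⟨
    filterᵇ q (x ∷ filterᵇ p xs)    ≡⟨ cong (filterᵇ q) (filterᵇ-accept xs px) ⟨
    filterᵇ q (filterᵇ p (x ∷ xs))  ∎
  byCases false true px qx = begin
    filterᵇ p (filterᵇ q (x ∷ xs))  ≡⟨ cong (filterᵇ p) (filterᵇ-accept xs qx) ⟩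
    filterᵇ p (x ∷ filterᵇ q xs)    ≡⟨ filterᵇ-reject (filterᵇ q xs) px ⟩
    filterᵇ p (filterᵇ q xs)        ≡⟨ filterᵇ-comm p q xs ⟩
    filterᵇ q (filterᵇ p xs)        ≡⟨ cong (filterᵇ q) (filterᵇ-reject xs px) ⟨
    filterᵇ q (filterᵇ p (x ∷ xs))  ∎
  byCases false false px qx = begin
    filterᵇ p (filterᵇ q (x ∷ xs))  ≡⟨ cong (filterᵇ p) (filterᵇ-reject xs qx) ⟩
    filterᵇ p (filterᵇ q xs)        ≡⟨ filterᵇ-comm p q xs ⟩
    filterᵇ q (filterᵇ p xs)        ≡⟨ cong (filterᵇ q) (filterᵇ-reject xs px) ⟨
    filterᵇ q (filterᵇ p (x ∷ xs))  ∎

count-sublists-∷ : ∀ {A : Set} (q : List A → Bool) (x : A) (L : List A) →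
  length (filterᵇ q (sublists (x ∷ L)))
    ≡ length (filterᵇ (q ∘ (x ∷_)) (sublists L)) + length (filterᵇ q (sublists L))
count-sublists-∷ q x L =
  begin
    length (filterᵇ q (map (x ∷_) (sublists L) ++ sublists L))
  ≡⟨ cong length (filter-++ (T? ∘ q) (map (x ∷_) (sublists L)) (sublists L)) ⟩
    length (filterᵇ q (map (x ∷_) (sublists L)) ++ filterᵇ q (sublists L))
  ≡⟨ length-++ (filterᵇ q (map (x ∷_) (sublists L))) ⟩
    length (filterᵇ q (map (x ∷_) (sublists L))) + length (filterᵇ q (sublists L))
  ≡⟨ cong (λ l → length l + length (filterᵇ q (sublists L))) (filterᵇ-map q (x ∷_) (sublists L)) ⟩
    length (map (x ∷_) (filterᵇ (q ∘ (x ∷_)) (sublists L))) + length (filterᵇ q (sublists L))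
  ≡⟨ cong (_+ length (filterᵇ q (sublists L))) (length-map (x ∷_) (filterᵇ (q ∘ (x ∷_)) (sublists L))) ⟩
    length (filterᵇ (q ∘ (x ∷_)) (sublists L)) + length (filterᵇ q (sublists L))
  ∎
  where open ≡-Reasoning

count-sublists-allᵇ : ∀ {A : Set} (p : A → Bool) (q : List A → Bool) (L : List A) →
  length (filterᵇ (λ s → allᵇ p s ∧ q s) (sublists L)) ≡ length (filterᵇ q (sublists (filterᵇ p L)))
count-sublists-allᵇ p q [] with q []
... | true  = refl
... | false = refl
count-sublists-allᵇ p q (x ∷ L) with p x in px
... | true =
  begin
    length (filterᵇ (λ s → allᵇ p s ∧ q s) (sublists (x ∷ L)))
  ≡⟨ count-sublists-∷ (λ s → allᵇ p s ∧ q s) x L ⟩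
    length (filterᵇ (λ s → (p x ∧ allᵇ p s) ∧ q (x ∷ s)) (sublists L)) + length (filterᵇ (λ s → allᵇ p s ∧ q s) (sublists L))
  ≡⟨ cong (_+ _) (cong length (filterᵇ-cong (All.universal (λ s → cong (λ b → (b ∧ allᵇ p s) ∧ q (x ∷ s)) px) (sublists L)))) ⟩
    length (filterᵇ (λ s → allᵇ p s ∧ q (x ∷ s)) (sublists L)) + length (filterᵇ (λ s → allᵇ p s ∧ q s) (sublists L))
  ≡⟨ cong₂ _+_ (count-sublists-allᵇ p (q ∘ (x ∷_)) L) (count-sublists-allᵇ p q L) ⟩
    length (filterᵇ (q ∘ (x ∷_)) (sublists (filterᵇ p L))) + length (filterᵇ q (sublists (filterᵇ p L)))
  ≡⟨ count-sublists-∷ q x (filterᵇ p L) ⟨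
    length (filterᵇ q (sublists (x ∷ filterᵇ p L)))
  ∎
  where open ≡-Reasoning
... | false =
  begin
    length (filterᵇ (λ s → allᵇ p s ∧ q s) (sublists (x ∷ L)))
  ≡⟨ count-sublists-∷ (λ s → allᵇ p s ∧ q s) x L ⟩
    length (filterᵇ (λ s → (p x ∧ allᵇ p s) ∧ q (x ∷ s)) (sublists L)) + length (filterᵇ (λ s → allᵇ p s ∧ q s) (sublists L))
  ≡⟨ cong (_+ _) (cong length (filterᵇ-none (All.universal (λ s → cong (λ b → (b ∧ allᵇ p s) ∧ q (x ∷ s)) px) (sublists L)))) ⟩
    length (filterᵇ (λ s → allᵇ p s ∧ q s) (sublists L))
  ≡⟨ count-sublists-allᵇ p q L ⟩
    length (filterᵇ q (sublists (filterᵇ p L)))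
  ∎
  where open ≡-Reasoning

Pair : Set
Pair = ℕ × ℕ

disjoint : Pair → Pair → Bool
disjoint (a , b) (c , d) = not ((a ≡ᵇ c) ∨ (a ≡ᵇ d) ∨ (b ≡ᵇ c) ∨ (b ≡ᵇ d))

isMatching : List Pair → Bool
isMatching []       = true
isMatching (e ∷ es) = allᵇ (disjoint e) es ∧ isMatching es

matchings : List Pair → ℕ → ℕ
matchings L t = length (filterᵇ (λ s → (length s ≡ᵇ t) ∧ isMatching s) (sublists L))

matchings-zero : ∀ L → matchings L 0 ≡ 1
matchings-zero []      = refl
matchings-zero (e ∷ L) =
  trans (count-sublists-∷ (λ s → (length s ≡ᵇ 0) ∧ isMatching s) e L)
        (cong₂ _+_ (cong length (filterᵇ-none (All.universal (λ s → refl) (sublists L)))) (matchings-zero L))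

-- Deletion recurrence: a (t+1)-matching of e ∷ L either avoids e, or is e together
-- with a t-matching of the edges disjoint from e.
matchings-∷ : ∀ e L t → matchings (e ∷ L) (suc t) ≡ matchings (filterᵇ (disjoint e) L) t + matchings L (suc t)
matchings-∷ e L t =
  trans (count-sublists-∷ (λ s → (length s ≡ᵇ suc t) ∧ isMatching s) e L)
        (cong (_+ matchings L (suc t))
              (trans (cong length (filterᵇ-cong (All.universal reorder (sublists L))))
                     (count-sublists-allᵇ (disjoint e) (λ s → (length s ≡ᵇ t) ∧ isMatching s) L)))
  where
  reorder : ∀ s → (length s ≡ᵇ t) ∧ (allᵇ (disjoint e) s ∧ isMatching s)
                ≡ allᵇ (disjoint e) s ∧ ((length s ≡ᵇ t) ∧ isMatching s)
  reorder s =
    trans (sym (∧-assoc (length s ≡ᵇ t) (allᵇ (disjoint e) s) (isMatching s)))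
    (trans (cong (_∧ isMatching s) (∧-comm (length s ≡ᵇ t) (allᵇ (disjoint e) s)))
           (∧-assoc (allᵇ (disjoint e) s) (length s ≡ᵇ t) (isMatching s)))

T⇒≡true : ∀ {b} → T b → b ≡ true
T⇒≡true = Equivalence.to T-≡

¬T⇒≡false : ∀ {b} → ¬ T b → b ≡ false
¬T⇒≡false {false} _  = refl
¬T⇒≡false {true}  ¬t = ⊥-elim (¬t _)

≡ᵇ-refl : ∀ x → (x ≡ᵇ x) ≡ true
≡ᵇ-refl x = T⇒≡true (≡⇒≡ᵇ x x refl)

≢⇒≡ᵇ-false : ∀ {x y} → x ≢ y → (x ≡ᵇ y) ≡ false
≢⇒≡ᵇ-false {x} {y} x≢y = ¬T⇒≡false (x≢y ∘ ≡ᵇ⇒≡ x y)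

<⇒<ᵇ-true : ∀ {x y} → x < y → (x <ᵇ y) ≡ true
<⇒<ᵇ-true = T⇒≡true ∘ <⇒<ᵇ

≤⇒<ᵇ-false : ∀ {x y} → y ≤ x → (x <ᵇ y) ≡ false
≤⇒<ᵇ-false {x} {y} y≤x = ¬T⇒≡false (≤⇒≯ y≤x ∘ <ᵇ⇒< x y)

-- pairs S: the pairs (x , y) with x occurring before y in S, i.e. the edges of the
-- complete graph on the vertex list S.
pairs : List ℕ → List Pair
pairs []      = []
pairs (x ∷ S) = map (x ,_) S ++ pairs S

matchingsOn : (Pair → Bool) → List ℕ → ℕ → ℕ
matchingsOn P S t = matchings (filterᵇ P (pairs S)) t

remove : ℕ → List ℕ → List ℕ
remove y = filterᵇ (λ u → not (y ≡ᵇ u))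

Fresh : ℕ → List ℕ → Set
Fresh x S = All (λ u → (x ≡ᵇ u) ≡ false) S

neighbourSum : (Pair → Bool) → ℕ → List ℕ → List ℕ → ℕ → ℕ
neighbourSum P x S T t = sum (map (λ y → if P (x , y) then matchingsOn P (remove y S) t else 0) T)

pairs-All : ∀ {Q : ℕ → Set} {S} → All Q S → All (λ e → Q (proj₁ e) × Q (proj₂ e)) (pairs S)
pairs-All []         = []
pairs-All (qx ∷ qS) = Allₚ.++⁺ (Allₚ.map⁺ (All.map (qx ,_) qS)) (pairs-All qS)

pairs-sorted : ∀ {S} → AllPairs _<_ S → All (λ e → proj₁ e < proj₂ e) (pairs S)
pairs-sorted {[]}    []          = []
pairs-sorted {x ∷ S} (x<S ∷ S<) = Allₚ.++⁺ (Allₚ.map⁺ x<S) (pairs-sorted S<)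

pairs-filter : ∀ (p : ℕ → Bool) S →
  filterᵇ (λ e → p (proj₁ e) ∧ p (proj₂ e)) (pairs S) ≡ pairs (filterᵇ p S)
pairs-filter p []      = refl
pairs-filter p (z ∷ S) with p z in pz
... | true = trans (filter-++ (T? ∘ _) (map (z ,_) S) (pairs S))
  (cong₂ _++_ (trans (filterᵇ-map _ (z ,_) S) (cong (map (z ,_)) (filterᵇ-cong (All.universal (λ v → cong (_∧ p v) pz) S))))
              (pairs-filter p S))
... | false = trans (filter-++ (T? ∘ _) (map (z ,_) S) (pairs S))
  (cong₂ _++_ (trans (filterᵇ-map _ (z ,_) S) (cong (map (z ,_)) (filterᵇ-none (All.universal (λ v → cong (_∧ p v) pz) S))))
              (pairs-filter p S))

disjoint-fresh : ∀ x y u v → (x ≡ᵇ u) ≡ false → (x ≡ᵇ v) ≡ false →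
  disjoint (x , y) (u , v) ≡ not (y ≡ᵇ u) ∧ not (y ≡ᵇ v)
disjoint-fresh x y u v xu xv rewrite xu | xv with y ≡ᵇ u
... | true  = refl
... | false = refl

-- Expanding the star at a fresh vertex x edge by edge: a (t+1)-matching uses at most
-- one edge (x , y), and deleting x and y leaves the graph on remove y S.
matchings-star : ∀ P x S T t → Fresh x S →
  matchings (filterᵇ P (map (x ,_) T) ++ filterᵇ P (pairs S)) (suc t)
    ≡ neighbourSum P x S T t + matchingsOn P S (suc t)
matchings-star P x S []      t fresh = refl
matchings-star P x S (y ∷ T) t fresh with P (x , y)
... | false = matchings-star P x S T t fresh
... | true  =
  begin
    matchings ((x , y) ∷ star ++ rest) (suc t)
  ≡⟨ matchings-∷ (x , y) (star ++ rest) t ⟩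
    matchings (filterᵇ (disjoint (x , y)) (star ++ rest)) t + matchings (star ++ rest) (suc t)
  ≡⟨ cong (λ L → matchings L t + matchings (star ++ rest) (suc t))
          (trans (filter-++ (T? ∘ disjoint (x , y)) star rest) (cong₂ _++_ star-meets rest-avoids)) ⟩
    matchingsOn P (remove y S) t + matchings (star ++ rest) (suc t)
  ≡⟨ cong (matchingsOn P (remove y S) t +_) (matchings-star P x S T t fresh) ⟩
    matchingsOn P (remove y S) t + (neighbourSum P x S T t + matchingsOn P S (suc t))
  ≡⟨ +-assoc (matchingsOn P (remove y S) t) _ _ ⟨
    matchingsOn P (remove y S) t + neighbourSum P x S T t + matchingsOn P S (suc t)
  ∎
  where
  open ≡-Reasoning
  star rest : List Pair
  star = filterᵇ P (map (x ,_) T)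
  rest = filterᵇ P (pairs S)
  star-meets : filterᵇ (disjoint (x , y)) star ≡ []
  star-meets = trans (filterᵇ-comm (disjoint (x , y)) P (map (x ,_) T))
    (cong (filterᵇ P) (trans (filterᵇ-map (disjoint (x , y)) (x ,_) T) (cong (map (x ,_))
      (filterᵇ-none (All.universal (λ z → cong (λ b → not (b ∨ (x ≡ᵇ z) ∨ (y ≡ᵇ x) ∨ (y ≡ᵇ z))) (≡ᵇ-refl x)) T)))))
  rest-avoids : filterᵇ (disjoint (x , y)) rest ≡ filterᵇ P (pairs (remove y S))
  rest-avoids = trans (filterᵇ-comm (disjoint (x , y)) P (pairs S))
    (cong (filterᵇ P) (trans (filterᵇ-cong (All.map (λ { {u , v} (xu , xv) → disjoint-fresh x y u v xu xv }) (pairs-All fresh)))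
                             (pairs-filter (λ u → not (y ≡ᵇ u)) S)))

-- Vertex recursion: a (t+1)-matching of the graph on x ∷ S either leaves x uncovered
-- or matches x with a neighbour y, the rest being a t-matching of the graph on S - y.
matchingsOn-∷ : ∀ P x S t → Fresh x S →
  matchingsOn P (x ∷ S) (suc t) ≡ neighbourSum P x S S t + matchingsOn P S (suc t)
matchingsOn-∷ P x S t fresh =
  trans (cong (λ L → matchings L (suc t)) (filter-++ (T? ∘ P) (map (x ,_) S) (pairs S)))
        (matchings-star P x S S t fresh)

count : (ℕ → Bool) → List ℕ → ℕ
count c S = length (filterᵇ c S)

count-++ : ∀ c xs ys → count c (xs ++ ys) ≡ count c xs + count c ys
count-++ c xs ys = trans (cong length (filter-++ (T? ∘ c) xs ys)) (length-++ (filterᵇ c xs))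

indicator : Bool → ℕ
indicator true  = 1
indicator false = 0

count-remove : ∀ c y S → y ∈ S → AllPairs _<_ S →
  count c (remove y S) + indicator (c y) ≡ count c S
count-remove c y (y ∷ S) (here refl) (y<S ∷ _)
  rewrite ≡ᵇ-refl y | filterᵇ-all (All.map (cong not ∘ ≢⇒≡ᵇ-false ∘ <⇒≢) y<S) with c y
... | true  = +-comm (count c S) 1
... | false = +-identityʳ (count c S)
count-remove c y (z ∷ S) (there y∈S) (z<S ∷ S<)
  rewrite ≢⇒≡ᵇ-false (>⇒≢ (All.lookup z<S y∈S)) with c z
... | true  = cong suc (count-remove c y S y∈S S<)
... | false = count-remove c y S y∈S S<

count-remove-in : ∀ c y S → y ∈ S → AllPairs _<_ S → c y ≡ true → count c (remove y S) ≡ pred (count c S)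
count-remove-in c y S y∈S S< cy =
  cong pred (trans (+-comm 1 _)
                   (trans (cong (λ b → count c (remove y S) + indicator b) (sym cy)) (count-remove c y S y∈S S<)))

count-remove-out : ∀ c y S → y ∈ S → AllPairs _<_ S → c y ≡ false → count c (remove y S) ≡ count c S
count-remove-out c y S y∈S S< cy =
  trans (sym (+-identityʳ _))
        (trans (cong (λ b → count c (remove y S) + indicator b) (sym cy)) (count-remove c y S y∈S S<))

sum-cong-∈ : ∀ (f g : ℕ → ℕ) S → (∀ {y} → y ∈ S → f y ≡ g y) → sum (map f S) ≡ sum (map g S)
sum-cong-∈ f g S h = cong sum (map-cong-local (All.tabulate h))

sum-if : ∀ (c : ℕ → Bool) (K : ℕ) S → sum (map (λ y → if c y then K else 0) S) ≡ count c S * K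
sum-if c K [] = refl
sum-if c K (x ∷ S) with c x
... | true  = cong (K +_) (sum-if c K S)
... | false = sum-if c K S

sum-+ : ∀ (f g : ℕ → ℕ) S → sum (map (λ y → f y + g y) S) ≡ sum (map f S) + sum (map g S)
sum-+ f g []      = refl
sum-+ f g (x ∷ S) rewrite sum-+ f g S = interchange (f x) (g x) (sum (map f S)) (sum (map g S))
  where
  interchange : ∀ a b c d → a + b + (c + d) ≡ a + c + (b + d)
  interchange = solve-∀

sameSide : (ℕ → Bool) → Pair → Bool
sameSide c (u , v) = (c u ∧ c v) ∨ (not (c u) ∧ not (c v))

sameSide-in : ∀ c x y → c x ≡ true → sameSide c (x , y) ≡ c y
sameSide-in c x y cx rewrite cx with c y
... | true  = refl
... | false = refl

sameSide-out : ∀ c x y → c x ≡ false → sameSide c (x , y) ≡ not (c y)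
sameSide-out c x y cx rewrite cx = refl

SameSideCount : (ℕ → Bool) → List ℕ → ℕ → Set
SameSideCount c S t = matchingsOn (sameSide c) S t ≡ mKK (count c S) (count (not ∘ c) S) t

-- If c x holds, x is adjacent to the p vertices of S on the c-side, and deleting any one
-- of them leaves K_(p-1) ∪ K_q.
neighbourSum-sameSide-in : ∀ c x S t → AllPairs _<_ S → c x ≡ true →
  (∀ y → SameSideCount c (remove y S) t) →
  neighbourSum (sameSide c) x S S t ≡ count c S * mKK (pred (count c S)) (count (not ∘ c) S) t
neighbourSum-sameSide-in c x S t S< cx afterRemoving =
  trans (sum-cong-∈ _ (λ y → if c y then K else 0) S neighbour) (sum-if c K S)
  where
  K : ℕ
  K = mKK (pred (count c S)) (count (not ∘ c) S) t
  neighbour : ∀ {y} → y ∈ S →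
    (if sameSide c (x , y) then matchingsOn (sameSide c) (remove y S) t else 0) ≡ (if c y then K else 0)
  neighbour {y} y∈S rewrite sameSide-in c x y cx with c y in cy
  ... | false = refl
  ... | true  = trans (afterRemoving y)
    (cong₂ (λ a b → mKK a b t) (count-remove-in c y S y∈S S< cy) (count-remove-out (not ∘ c) y S y∈S S< (cong not cy)))

-- If c x fails, x is adjacent to the q vertices of S on the other side, and deleting any
-- one of them leaves K_p ∪ K_(q-1).
neighbourSum-sameSide-out : ∀ c x S t → AllPairs _<_ S → c x ≡ false →
  (∀ y → SameSideCount c (remove y S) t) →
  neighbourSum (sameSide c) x S S t ≡ count (not ∘ c) S * mKK (count c S) (pred (count (not ∘ c) S)) t
neighbourSum-sameSide-out c x S t S< cx afterRemoving =
  trans (sum-cong-∈ _ (λ y → if not (c y) then K else 0) S neighbour) (sum-if (not ∘ c) K S)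
  where
  K : ℕ
  K = mKK (count c S) (pred (count (not ∘ c) S)) t
  neighbour : ∀ {y} → y ∈ S →
    (if sameSide c (x , y) then matchingsOn (sameSide c) (remove y S) t else 0) ≡ (if not (c y) then K else 0)
  neighbour {y} y∈S rewrite sameSide-out c x y cx with c y in cy
  ... | true  = refl
  ... | false = trans (afterRemoving y)
    (cong₂ (λ a b → mKK a b t) (count-remove-out c y S y∈S S< cy) (count-remove-in (not ∘ c) y S y∈S S< (cong not cy)))

-- On a strictly increasing vertex list S, the same-side graph of c is K_p ∪ K_q.
-- Induction on t, then on S: the vertex x joins K_p when c x holds and K_q otherwise.
matchingsOn-sameSide : ∀ c S → AllPairs _<_ S → ∀ t → SameSideCount c S t
matchingsOn-sameSide c S       S<          zero    =
  trans (matchings-zero (filterᵇ (sameSide c) (pairs S))) (sym (mKK-zero (count c S) (count (not ∘ c) S)))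
matchingsOn-sameSide c []      []          (suc t) = refl
matchingsOn-sameSide c (x ∷ S) (x<S ∷ S<) (suc t) =
  begin
    matchingsOn (sameSide c) (x ∷ S) (suc t)
  ≡⟨ matchingsOn-∷ (sameSide c) x S t (All.map (≢⇒≡ᵇ-false ∘ <⇒≢) x<S) ⟩
    neighbourSum (sameSide c) x S S t + matchingsOn (sameSide c) S (suc t)
  ≡⟨ cong (neighbourSum (sameSide c) x S S t +_) (matchingsOn-sameSide c S S< (suc t)) ⟩
    neighbourSum (sameSide c) x S S t + mKK p q (suc t)
  ≡⟨ addVertex (c x) refl ⟩
    mKK (count c (x ∷ S)) (count (not ∘ c) (x ∷ S)) (suc t)
  ∎
  where
  open ≡-Reasoning
  p q : ℕ
  p = count c S
  q = count (not ∘ c) S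
  afterRemoving : ∀ y → SameSideCount c (remove y S) t
  afterRemoving y = matchingsOn-sameSide c (remove y S) (AllPairsₚ.filter⁺ _ S<) t
  addVertex : ∀ b → c x ≡ b →
    neighbourSum (sameSide c) x S S t + mKK p q (suc t) ≡ mKK (count c (x ∷ S)) (count (not ∘ c) (x ∷ S)) (suc t)
  addVertex true cx =
    begin
      neighbourSum (sameSide c) x S S t + mKK p q (suc t)
    ≡⟨ cong (_+ mKK p q (suc t)) (neighbourSum-sameSide-in c x S t S< cx afterRemoving) ⟩
      p * mKK (pred p) q t + mKK p q (suc t)
    ≡⟨ trans (+-comm (p * mKK (pred p) q t) _) (sym (mKK-row p q t)) ⟩
      mKK (suc p) q (suc t)
    ≡⟨ cong₂ (λ a b → mKK (length a) (length b) (suc t)) (filterᵇ-accept S cx) (filterᵇ-reject S (cong not cx)) ⟨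
      mKK (count c (x ∷ S)) (count (not ∘ c) (x ∷ S)) (suc t)
    ∎
  addVertex false cx =
    begin
      neighbourSum (sameSide c) x S S t + mKK p q (suc t)
    ≡⟨ cong (_+ mKK p q (suc t)) (neighbourSum-sameSide-out c x S t S< cx afterRemoving) ⟩
      q * mKK p (pred q) t + mKK p q (suc t)
    ≡⟨ +-comm (q * mKK p (pred q) t) _ ⟩
      mKK p (suc q) (suc t)
    ≡⟨ cong₂ (λ a b → mKK (length a) (length b) (suc t)) (filterᵇ-reject S cx) (filterᵇ-accept S (cong not cx)) ⟨
      mKK (count c (x ∷ S)) (count (not ∘ c) (x ∷ S)) (suc t)
    ∎

toPair : ∀ {n} → Edge n → Pair
toPair (i , j) = (toℕ i , toℕ j)

sublists-map : ∀ {A B : Set} (f : A → B) (L : List A) → sublists (map f L) ≡ map (map f) (sublists L)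
sublists-map f []      = refl
sublists-map f (x ∷ L) =
  begin
    map (f x ∷_) (sublists (map f L)) ++ sublists (map f L)
  ≡⟨ cong (λ r → map (f x ∷_) r ++ r) (sublists-map f L) ⟩
    map (f x ∷_) (map (map f) (sublists L)) ++ map (map f) (sublists L)
  ≡⟨ cong (_++ map (map f) (sublists L)) (trans (sym (map-∘ (sublists L))) (map-∘ (sublists L))) ⟩
    map (map f) (map (x ∷_) (sublists L)) ++ map (map f) (sublists L)
  ≡⟨ map-++ (map f) (map (x ∷_) (sublists L)) (sublists L) ⟨
    map (map f) (map (x ∷_) (sublists L) ++ sublists L)
  ∎
  where open ≡-Reasoning

isMatching-toPair : ∀ {n} (s : List (Edge n)) → isMatching (map toPair s) ≡ matchingᵇ s
isMatching-toPair []      = refl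
isMatching-toPair (e ∷ s) = cong₂ _∧_ (allᵇ-toPair e s) (isMatching-toPair s)
  where
  allᵇ-toPair : ∀ {n} (e : Edge n) es → allᵇ (disjoint (toPair e)) (map toPair es) ≡ allᵇ (disjointᵇ e) es
  allᵇ-toPair e []       = refl
  allᵇ-toPair e (f ∷ es) = cong (disjointᵇ e f ∧_) (allᵇ-toPair e es)

m≡matchings : ∀ {n} (G : Graph n) t → m G t ≡ matchings (map toPair (edges G)) t
m≡matchings G t = sym (
  begin
    length (filterᵇ q (sublists (map toPair (edges G))))
  ≡⟨ cong (length ∘ filterᵇ q) (sublists-map toPair (edges G)) ⟩
    length (filterᵇ q (map (map toPair) (sublists (edges G))))
  ≡⟨ cong length (filterᵇ-map q (map toPair) (sublists (edges G))) ⟩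
    length (map (map toPair) (filterᵇ (q ∘ map toPair) (sublists (edges G))))
  ≡⟨ length-map (map toPair) (filterᵇ (q ∘ map toPair) (sublists (edges G))) ⟩
    length (filterᵇ (q ∘ map toPair) (sublists (edges G)))
  ≡⟨ cong length (filterᵇ-cong (All.universal transport (sublists (edges G)))) ⟩
    m G t
  ∎)
  where
  open ≡-Reasoning
  q : List Pair → Bool
  q s = (length s ≡ᵇ t) ∧ isMatching s
  transport : ∀ s → q (map toPair s) ≡ (length s ≡ᵇ t) ∧ matchingᵇ s
  transport s = cong₂ (λ l b → (l ≡ᵇ t) ∧ b) (length-map toPair s) (isMatching-toPair s)

range : ℕ → ℕ → List ℕ
range s zero    = []
range s (suc k) = s ∷ range (suc s) k

range-≥ : ∀ s k → All (s ≤_) (range s k)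
range-≥ s zero    = []
range-≥ s (suc k) = ≤-refl ∷ All.map (≤-trans (n≤1+n s)) (range-≥ (suc s) k)

range-sorted : ∀ s k → AllPairs _<_ (range s k)
range-sorted s zero    = []
range-sorted s (suc k) = range-≥ (suc s) k ∷ range-sorted (suc s) k

allFin-range : ∀ n → map toℕ (allFin n) ≡ range 0 n
allFin-range n = trans (map-tabulate (λ i → i) toℕ) (tabulate-range n 0 toℕ (λ i → refl))
  where
  tabulate-range : ∀ n s (f : Fin n → ℕ) → (∀ i → f i ≡ s + toℕ i) → tabulate f ≡ range s n
  tabulate-range zero    s f h = refl
  tabulate-range (suc n) s f h = cong₂ _∷_ (trans (h Fin.zero) (+-identityʳ s))
    (tabulate-range n (suc s) (f ∘ Fin.suc) (λ i → trans (h (Fin.suc i)) (+-suc s (toℕ i))))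

square : List ℕ → List ℕ → List Pair
square T I = concatMap (λ z → map (z ,_) I) T

aboveDiagonal : (Pair → Bool) → Pair → Bool
aboveDiagonal Q e = (proj₁ e <ᵇ proj₂ e) ∧ Q e

square-dropColumn : ∀ Q x T I → All (x <_) T →
  filterᵇ (aboveDiagonal Q) (square T (x ∷ I)) ≡ filterᵇ (aboveDiagonal Q) (square T I)
square-dropColumn Q x []      I []          = refl
square-dropColumn Q x (z ∷ T) I (x<z ∷ x<T) rewrite ≤⇒<ᵇ-false {z} {x} (<⇒≤ x<z) =
  trans (filter-++ (T? ∘ aboveDiagonal Q) (map (z ,_) I) (square T (x ∷ I)))
  (trans (cong (filterᵇ (aboveDiagonal Q) (map (z ,_) I) ++_) (square-dropColumn Q x T I x<T))
         (sym (filter-++ (T? ∘ aboveDiagonal Q) (map (z ,_) I) (square T I))))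

row-aboveDiagonal : ∀ Q x I → All (x <_) I → filterᵇ (aboveDiagonal Q) (map (x ,_) I) ≡ filterᵇ Q (map (x ,_) I)
row-aboveDiagonal Q x I x<I =
  filterᵇ-cong (Allₚ.map⁺ (All.map (λ {v} x<v → cong (_∧ Q (x , v)) (<⇒<ᵇ-true x<v)) x<I))

square-aboveDiagonal : ∀ Q S → AllPairs _<_ S → filterᵇ (aboveDiagonal Q) (square S S) ≡ filterᵇ Q (pairs S)
square-aboveDiagonal Q []      [] = refl
square-aboveDiagonal Q (x ∷ S) (x<S ∷ S<) rewrite ≤⇒<ᵇ-false {x} {x} ≤-refl =
  trans (filter-++ (T? ∘ aboveDiagonal Q) (map (x ,_) S) (square S (x ∷ S)))
  (trans (cong₂ _++_ (row-aboveDiagonal Q x S x<S)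
                     (trans (square-dropColumn Q x S S x<S) (square-aboveDiagonal Q S S<)))
         (sym (filter-++ (T? ∘ Q) (map (x ,_) S) (pairs S))))

K1-adj : ℕ → Pair → Bool
K1-adj a (x , y) =
  not (x ≡ᵇ y) ∧ (((x <ᵇ a) ∧ (y <ᵇ a)) ∨ (not (x <ᵇ a) ∧ not (y <ᵇ a))
                  ∨ ((x ≡ᵇ 0) ∧ (y ≡ᵇ a)) ∨ ((x ≡ᵇ a) ∧ (y ≡ᵇ 0)))

edges-K1 : ∀ a b → map toPair (edges (K1 a b)) ≡ filterᵇ (K1-adj a) (pairs (range 0 (a + b)))
edges-K1 a b =
  begin
    map toPair (filterᵇ _ grid)
  ≡⟨ cong (map toPair) (filterᵇ-cong (All.universal (λ { (i , j) → refl }) grid)) ⟩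
    map toPair (filterᵇ (aboveDiagonal (K1-adj a) ∘ toPair) grid)
  ≡⟨ filterᵇ-map (aboveDiagonal (K1-adj a)) toPair grid ⟨
    filterᵇ (aboveDiagonal (K1-adj a)) (map toPair grid)
  ≡⟨ cong (filterᵇ (aboveDiagonal (K1-adj a))) grid-square ⟩
    filterᵇ (aboveDiagonal (K1-adj a)) (square (range 0 n) (range 0 n))
  ≡⟨ square-aboveDiagonal (K1-adj a) (range 0 n) (range-sorted 0 n) ⟩
    filterᵇ (K1-adj a) (pairs (range 0 n))
  ∎
  where
  open ≡-Reasoning
  n : ℕ
  n = a + b
  grid : List (Edge n)
  grid = concatMap (λ i → map (λ j → (i , j)) (allFin n)) (allFin n)
  grid-square : map toPair grid ≡ square (range 0 n) (range 0 n)
  grid-square =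
    trans (map-concatMap toPair (λ i → map (λ j → (i , j)) (allFin n)) (allFin n))
    (trans (concatMap-cong (λ i → trans (sym (map-∘ (allFin n))) (map-∘ (allFin n))) (allFin n))
    (trans (sym (concatMap-map (λ z → map (z ,_) (map toℕ (allFin n))) toℕ (allFin n)))
           (cong (λ X → square X X) (allFin-range n))))

length-range : ∀ s k → length (range s k) ≡ k
length-range s zero    = refl
length-range s (suc k) = cong suc (length-range (suc s) k)

range-++ : ∀ s i j → range s (i + j) ≡ range s i ++ range (s + i) j
range-++ s zero    j = cong (λ x → range x j) (sym (+-identityʳ s))
range-++ s (suc i) j =
  cong (s ∷_) (trans (range-++ (suc s) i j) (cong (λ x → range (suc s) i ++ range x j) (sym (+-suc s i))))

range-< : ∀ s i → All (_< s + i) (range s i)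
range-< s zero    = []
range-< s (suc i) rewrite +-suc s i = s≤s (m≤m+n s i) ∷ range-< (suc s) i

count-below : ∀ s i j → count (_<ᵇ s + i) (range s (i + j)) ≡ i
count-below s i j rewrite range-++ s i j | count-++ (_<ᵇ s + i) (range s i) (range (s + i) j)
  | filterᵇ-all (All.map <⇒<ᵇ-true (range-< s i)) | filterᵇ-none (All.map ≤⇒<ᵇ-false (range-≥ (s + i) j))
  = trans (+-identityʳ _) (length-range s i)

count-above : ∀ s i j → count (not ∘ (_<ᵇ s + i)) (range s (i + j)) ≡ j
count-above s i j rewrite range-++ s i j | count-++ (not ∘ (_<ᵇ s + i)) (range s i) (range (s + i) j)
  | filterᵇ-none (All.map (cong not ∘ <⇒<ᵇ-true) (range-< s i))
  | filterᵇ-all (All.map (cong not ∘ ≤⇒<ᵇ-false) (range-≥ (s + i) j))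
  = length-range (s + i) j

count-equal : ∀ s i j → count (_≡ᵇ s + i) (range s (i + suc j)) ≡ 1
count-equal s i j rewrite range-++ s i (suc j) | count-++ (_≡ᵇ s + i) (range s i) (range (s + i) (suc j))
  | filterᵇ-none (All.map (≢⇒≡ᵇ-false ∘ <⇒≢) (range-< s i)) | ≡ᵇ-refl (s + i)
  | filterᵇ-none (All.map (≢⇒≡ᵇ-false ∘ >⇒≢) (range-≥ (suc (s + i)) j))
  = refl

-- Away from vertex 0 the only non-clique edge of K1 cannot occur: K1 is the same-side
-- graph of the threshold a there.
K1-adj-sameSide : ∀ a u v → u < v → 1 ≤ u → K1-adj a (u , v) ≡ sameSide (_<ᵇ a) (u , v)
K1-adj-sameSide a (suc u) (suc v) u<v _ rewrite ≢⇒≡ᵇ-false (<⇒≢ u<v) =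
  noBridge ((suc u <ᵇ a) ∧ (suc v <ᵇ a)) (not (suc u <ᵇ a) ∧ not (suc v <ᵇ a)) (suc u ≡ᵇ a)
  where
  noBridge : ∀ x y c → x ∨ y ∨ false ∨ (c ∧ false) ≡ x ∨ y
  noBridge true  y     c     = refl
  noBridge false true  c     = refl
  noBridge false false true  = refl
  noBridge false false false = refl

matchingsOn-K1-adj : ∀ a S → AllPairs _<_ S → All (1 ≤_) S → ∀ t →
  matchingsOn (K1-adj a) S t ≡ mKK (count (_<ᵇ a) S) (count (not ∘ (_<ᵇ a)) S) t
matchingsOn-K1-adj a S S< S≥1 t =
  trans (cong (λ L → matchings L t)
          (filterᵇ-cong (All.zipWith (λ { {u , v} (u<v , (u≥1 , _)) → K1-adj-sameSide a u v u<v u≥1 })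
                                     (pairs-sorted S< , pairs-All S≥1))))
        (matchingsOn-sameSide (_<ᵇ a) S S< t)

nonRoot : ℕ → ℕ → List ℕ
nonRoot a b = range 1 (a + suc b)

K1-delete-nonRoot : ∀ a b t y → matchingsOn (K1-adj (suc a)) (remove y (nonRoot a b)) t
  ≡ mKK (count (_<ᵇ suc a) (remove y (nonRoot a b))) (count (not ∘ (_<ᵇ suc a)) (remove y (nonRoot a b))) t
K1-delete-nonRoot a b t y =
  matchingsOn-K1-adj (suc a) (remove y (nonRoot a b))
    (AllPairsₚ.filter⁺ _ (range-sorted 1 (a + suc b))) (Allₚ.filter⁺ _ (range-≥ 1 (a + suc b))) t

-- The root 0 of K1 (a+1) (b+1) is adjacent to the a other vertices of K_(a+1) and,
-- across the bridge, to the vertex a+1.  Deleting such a neighbour y as well leaves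
-- K_(a-1) ∪ K_(b+1), respectively K_a ∪ K_b.
K1-root-neighbour : ∀ a b t {y} → y ∈ nonRoot a b →
  (if K1-adj (suc a) (0 , y) then matchingsOn (K1-adj (suc a)) (remove y (nonRoot a b)) t else 0)
    ≡ (if y <ᵇ suc a then mKK (pred a) (suc b) t else 0) + (if y ≡ᵇ suc a then mKK a b t else 0)
K1-root-neighbour a b t {zero}  y∈S with () ← All.lookup (range-≥ 1 (a + suc b)) y∈S
K1-root-neighbour a b t {suc y} y∈S with suc y <ᵇ suc a in below
... | true rewrite ≢⇒≡ᵇ-false (<⇒≢ (<ᵇ⇒< (suc y) (suc a) (subst T (sym below) _))) =
  trans (K1-delete-nonRoot a b t (suc y))
        (trans (cong₂ (λ p q → mKK p q t)
                 (trans (count-remove-in (_<ᵇ suc a) (suc y) (nonRoot a b) y∈S (range-sorted 1 (a + suc b)) below)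
                        (cong pred (count-below 1 a (suc b))))
                 (trans (count-remove-out (not ∘ (_<ᵇ suc a)) (suc y) (nonRoot a b) y∈S (range-sorted 1 (a + suc b)) (cong not below))
                        (count-above 1 a (suc b))))
               (sym (+-identityʳ (mKK (pred a) (suc b) t))))
... | false with suc y ≡ᵇ suc a
...   | true =
  trans (K1-delete-nonRoot a b t (suc y))
        (cong₂ (λ p q → mKK p q t)
          (trans (count-remove-out (_<ᵇ suc a) (suc y) (nonRoot a b) y∈S (range-sorted 1 (a + suc b)) below)
                 (count-below 1 a (suc b)))
          (trans (count-remove-in (not ∘ (_<ᵇ suc a)) (suc y) (nonRoot a b) y∈S (range-sorted 1 (a + suc b)) (cong not below))
                 (cong pred (count-above 1 a (suc b)))))
...   | false = refl

neighbourSum-K1-root : ∀ a b t →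
  neighbourSum (K1-adj (suc a)) 0 (nonRoot a b) (nonRoot a b) t ≡ a * mKK (pred a) (suc b) t + 1 * mKK a b t
neighbourSum-K1-root a b t =
  begin
    neighbourSum (K1-adj (suc a)) 0 S S t
  ≡⟨ sum-cong-∈ _ _ S (K1-root-neighbour a b t) ⟩
    sum (map (λ y → (if y <ᵇ suc a then K₁ else 0) + (if y ≡ᵇ suc a then K₂ else 0)) S)
  ≡⟨ sum-+ (λ y → if y <ᵇ suc a then K₁ else 0) (λ y → if y ≡ᵇ suc a then K₂ else 0) S ⟩
    sum (map (λ y → if y <ᵇ suc a then K₁ else 0) S) + sum (map (λ y → if y ≡ᵇ suc a then K₂ else 0) S)
  ≡⟨ cong₂ _+_ (sum-if (_<ᵇ suc a) K₁ S) (sum-if (_≡ᵇ suc a) K₂ S) ⟩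
    count (_<ᵇ suc a) S * K₁ + count (_≡ᵇ suc a) S * K₂
  ≡⟨ cong₂ (λ i j → i * K₁ + j * K₂) (count-below 1 a (suc b)) (count-equal 1 a b) ⟩
    a * K₁ + 1 * K₂
  ∎
  where
  open ≡-Reasoning
  S : List ℕ
  S = nonRoot a b
  K₁ K₂ : ℕ
  K₁ = mKK (pred a) (suc b) t
  K₂ = mKK a b t

-- Deleting the root 0 of K1 (a+1) (b+1): in a (t+1)-matching, 0 is unmatched (leaving
-- K_a ∪ K_(b+1)) or matched to a neighbour; with the row recursion of mKK this gives
-- m(K1 (a+1) (b+1), t+1) = m(K_(a+1) ∪ K_(b+1), t+1) + m(K_a ∪ K_b, t).
matchings-K1 : ∀ a b t → m (K1 (suc a) (suc b)) (suc t) ≡ mKK (suc a) (suc b) (suc t) + mKK a b t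
matchings-K1 a b t =
  begin
    m (K1 (suc a) (suc b)) (suc t)
  ≡⟨ m≡matchings (K1 (suc a) (suc b)) (suc t) ⟩
    matchings (map toPair (edges (K1 (suc a) (suc b)))) (suc t)
  ≡⟨ cong (λ L → matchings L (suc t)) (edges-K1 (suc a) (suc b)) ⟩
    matchingsOn (K1-adj (suc a)) (0 ∷ nonRoot a b) (suc t)
  ≡⟨ matchingsOn-∷ (K1-adj (suc a)) 0 (nonRoot a b) t (All.map (λ { (s≤s _) → refl }) (range-≥ 1 (a + suc b))) ⟩
    neighbourSum (K1-adj (suc a)) 0 (nonRoot a b) (nonRoot a b) t + matchingsOn (K1-adj (suc a)) (nonRoot a b) (suc t)
  ≡⟨ cong₂ _+_ (neighbourSum-K1-root a b t) withoutRoot ⟩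
    (a * mKK (pred a) (suc b) t + 1 * mKK a b t) + mKK a (suc b) (suc t)
  ≡⟨ rearrange (a * mKK (pred a) (suc b) t) (mKK a b t) (mKK a (suc b) (suc t)) ⟩
    (mKK a (suc b) (suc t) + a * mKK (pred a) (suc b) t) + mKK a b t
  ≡⟨ cong (_+ mKK a b t) (mKK-row a (suc b) t) ⟨
    mKK (suc a) (suc b) (suc t) + mKK a b t
  ∎
  where
  open ≡-Reasoning
  rearrange : ∀ x y z → (x + 1 * y) + z ≡ (z + x) + y
  rearrange = solve-∀
  withoutRoot : matchingsOn (K1-adj (suc a)) (nonRoot a b) (suc t) ≡ mKK a (suc b) (suc t)
  withoutRoot =
    trans (matchingsOn-K1-adj (suc a) (nonRoot a b) (range-sorted 1 (a + suc b)) (range-≥ 1 (a + suc b)) (suc t))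
          (cong₂ (λ p q → mKK p q (suc t)) (count-below 1 a (suc b)) (count-above 1 a (suc b)))

m-zero : ∀ a b → m (K1 a b) 0 ≡ 1
m-zero a b = trans (m≡matchings (K1 a b) 0) (matchings-zero (map toPair (edges (K1 a b))))

K1-comparison : ∀ p q t → m (K1 (suc p) (suc q)) (suc t) ≤ m (K1 (suc (p + q)) 1) (suc t)
K1-comparison p q t =
  begin
    m (K1 (suc p) (suc q)) (suc t)
  ≡⟨ matchings-K1 p q t ⟩
    mKK (suc p) (suc q) (suc t) + mKK p q t
  ≤⟨ twoCliques≤clique p q t ⟩
    mK (suc (p + q)) (suc t) + mK (p + q) t
  ≡⟨ cong (_+ mK (p + q) t) (+-identityʳ (mK (suc (p + q)) (suc t))) ⟨
    mKK (suc (p + q)) 1 (suc t) + mKK (p + q) 0 t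
  ≡⟨ matchings-K1 (p + q) 0 t ⟨
    m (K1 (suc (p + q)) 1) (suc t)
  ∎
  where open ≤-Reasoning

k+k≤n : ∀ n k → k ≤ n / 2 → k + k ≤ n
k+k≤n n k k≤n/2 =
  ≤-trans (≤-reflexive (trans (cong (k +_) (sym (+-identityʳ k))) (*-comm 2 k)))
          (≤-trans (*-monoˡ-≤ 2 k≤n/2) (m/n*n≤m n 2))

split-sizes : ∀ n q → suc q ≤ n / 2 → Σ ℕ λ p → n ∸ suc q ≡ suc p × n ∸ 1 ≡ suc (p + q)
split-sizes n q k≤n/2 with n ∸ suc q in n∸k | m+n≤o⇒m≤o∸n (suc q) (k+k≤n n (suc q) k≤n/2)
... | suc p | _ = p , refl , trans (cong (_∸ 1) n≡) (+-suc p q)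
  where
  n≡ : n ≡ suc p + suc q
  n≡ = trans (sym (m∸n+n≡m (m+n≤o⇒n≤o (suc q) (k+k≤n n (suc q) k≤n/2)))) (cong (_+ suc q) n∸k)

-- Lemma 2.7.  For t = 0 both sides are 1; otherwise write k = q+1 and n - k = p+1 and
-- apply K1-comparison.
lemma2p7 : (n k : ℕ) → 2 ≤ k → k ≤ n / 2 →
    (t : ℕ) → t ≤ n / 2 → m (K1 (n ∸ k) k) t ≤ m (K1 (n ∸ 1) 1) t
lemma2p7 n k       _       _     zero    _ = ≤-reflexive (trans (m-zero (n ∸ k) k) (sym (m-zero (n ∸ 1) 1)))
lemma2p7 n (suc q) (s≤s _) k≤n/2 (suc t) _ with split-sizes n q k≤n/2
... | p , n∸k≡1+p , n∸1≡1+p+q rewrite n∸k≡1+p | n∸1≡1+p+q = K1-comparison p q t
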